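{- Let $\mathcal{C}$ be a category with binary products and let $\mathcal{C}^{op}$ be its opposite category, in which binary products of $\mathcal{C}$ become binary coproducts (sums), with the projections $\mathrm{pr}_1: A\times B\to A$, $\mathrm{pr}_2: A\times B\to B$ of $\mathcal{C}$ becoming the coprojections $\mathrm{inl}: A\to A+B$, $\mathrm{inr}: B\to A+B$ of $\mathcal{C}^{op}$. Let $I$ be an index set, $S$ an object of $\mathcal{C}$, and $(V_i)_{i\in I}$ objects of $\mathcal{C}$. Then the following two kinds of data are in bijection, by reversing all arrows (i.e. setting $t_i := l_i^{op}$ and $c_i := u_i^{op}$): (1) (semantics of states, in $\mathcal{C}$) families of morphisms $l_i: S\to V_i$ (lookup) and $u_i: V_i\times S\to S$ (update), $i\in I$, satisfying for each $i\in I$: $l_i\circ u_i = \mathrm{pr}_1$ (as morphisms $V_i\times S\to V_i$), and for each $j\neq i$ in $I$: $l_j\circ u_i = l_j\circ \mathrm{pr}_2$ (as morphisms $V_i\times S\to V_j$); (2) (semantics of exceptions, in $\mathcal{C}^{op}$) families of morphisms $t_i: V_i\to S$ (exception constructor) and $c_i: S\to V_i+S$ (exception recovery), $i\in I$, satisfying for each $i\in I$: $c_i\circ t_i = \mathrm{inl}$ (as morphisms $V_i\to V_i+S$), and for each $j\neq i$ in $I$: $c_i\circ t_j = \mathrm{inr}\circ t_j$ (as morphisms $V_j\to V_i+S$). In particular, in the category of sets, the lookup/update operations for states with their equations are categorically dual to the constructor/recovery operations for exceptions with their equations.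
   Context: In the set-theoretic semantics of states, $S$ is the set of states, $I$ the set of locations, $V_i$ the set of values of location $i$, $l_i(s)$ reads the value of location $i$ in state $s$, and $u_i(a,s)$ sets location $i$ to $a$ leaving the others unchanged; the equations say $l_i(u_i(a,s))=a$ and $l_j(u_i(a,s))=l_j(s)$ for $j\ne i$. In the set-theoretic semantics of exceptions, $S$ is the set of exceptions, $I$ a set of exception indices, $V_i$ the set of parameters of index $i$, $t_i$ tags a parameter as an exception, and $c_i$ returns the parameter $a$ if the exception is $t_i(a)$ and otherwise propagates the exception; the equations say $c_i(t_i(a))=a\in V_i\subseteq V_i+S$ and $c_i(t_j(b))=t_j(b)\in S\subseteq V_i+S$ for $j\neq i$. -}

module Defs where

open import Level using (Level; _⊔_) renaming (suc to lsuc)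
open import Relation.Binary using (Rel; IsEquivalence)
open import Relation.Binary.PropositionalEquality using (_≡_)
open import Relation.Nullary using (¬_)

record Category (o ℓ e : Level) : Set (lsuc (o ⊔ ℓ ⊔ e)) where
  infix  4 _≈_
  infixr 9 _∘_
  field
    Obj       : Set o
    _⇒_       : Obj → Obj → Set ℓ
    _≈_       : ∀ {A B} → Rel (A ⇒ B) e
    id        : ∀ {A} → A ⇒ A
    _∘_       : ∀ {A B C} → B ⇒ C → A ⇒ B → A ⇒ C
    equiv     : ∀ {A B} → IsEquivalence (_≈_ {A} {B})
    assoc     : ∀ {A B C D} {f : A ⇒ B} {g : B ⇒ C} {h : C ⇒ D} →
                (h ∘ g) ∘ f ≈ h ∘ (g ∘ f)
    identityˡ : ∀ {A B} {f : A ⇒ B} → id ∘ f ≈ f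
    identityʳ : ∀ {A B} {f : A ⇒ B} → f ∘ id ≈ f
    ∘-resp-≈  : ∀ {A B C} {f h : B ⇒ C} {g i : A ⇒ B} →
                f ≈ h → g ≈ i → f ∘ g ≈ h ∘ i

op : ∀ {o ℓ e} → Category o ℓ e → Category o ℓ e
op C = record
  { Obj       = Obj
  ; _⇒_       = λ A B → B ⇒ A
  ; _≈_       = _≈_
  ; id        = id
  ; _∘_       = λ f g → g ∘ f
  ; equiv     = equiv
  ; assoc     = IsEquivalence.sym equiv assoc
  ; identityˡ = identityʳ
  ; identityʳ = identityˡ
  ; ∘-resp-≈  = λ p q → ∘-resp-≈ q p
  }
  where open Category C

record BinaryProducts {o ℓ e} (C : Category o ℓ e) : Set (o ⊔ ℓ ⊔ e) where
  open Category C
  infixr 7 _×_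
  field
    _×_      : Obj → Obj → Obj
    π₁       : ∀ {A B} → (A × B) ⇒ A
    π₂       : ∀ {A B} → (A × B) ⇒ B
    ⟨_,_⟩    : ∀ {A B X} → X ⇒ A → X ⇒ B → X ⇒ (A × B)
    project₁ : ∀ {A B X} {f : X ⇒ A} {g : X ⇒ B} → π₁ ∘ ⟨ f , g ⟩ ≈ f
    project₂ : ∀ {A B X} {f : X ⇒ A} {g : X ⇒ B} → π₂ ∘ ⟨ f , g ⟩ ≈ g
    unique   : ∀ {A B X} {f : X ⇒ A} {g : X ⇒ B} {h : X ⇒ (A × B)} →
               π₁ ∘ h ≈ f → π₂ ∘ h ≈ g → ⟨ f , g ⟩ ≈ h

record BinaryCoproducts {o ℓ e} (C : Category o ℓ e) : Set (o ⊔ ℓ ⊔ e) where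
  open Category C
  infixr 6 _+_
  field
    _+_     : Obj → Obj → Obj
    inl     : ∀ {A B} → A ⇒ (A + B)
    inr     : ∀ {A B} → B ⇒ (A + B)
    [_,_]   : ∀ {A B X} → A ⇒ X → B ⇒ X → (A + B) ⇒ X
    inject₁ : ∀ {A B X} {f : A ⇒ X} {g : B ⇒ X} → [ f , g ] ∘ inl ≈ f
    inject₂ : ∀ {A B X} {f : A ⇒ X} {g : B ⇒ X} → [ f , g ] ∘ inr ≈ g
    unique  : ∀ {A B X} {f : A ⇒ X} {g : B ⇒ X} {h : (A + B) ⇒ X} →
              h ∘ inl ≈ f → h ∘ inr ≈ g → [ f , g ] ≈ h

op-coproducts : ∀ {o ℓ e} {C : Category o ℓ e} →
                BinaryProducts C → BinaryCoproducts (op C)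
op-coproducts P = record
  { _+_     = _×_
  ; inl     = π₁
  ; inr     = π₂
  ; [_,_]   = ⟨_,_⟩
  ; inject₁ = project₁
  ; inject₂ = project₂
  ; unique  = unique
  }
  where open BinaryProducts P

record StateSemantics {o ℓ e ι} (C : Category o ℓ e) (P : BinaryProducts C)
       (I : Set ι) (S : Category.Obj C) (V : I → Category.Obj C)
       : Set (o ⊔ ℓ ⊔ e ⊔ ι) where
  open Category C
  open BinaryProducts P
  field
    l      : (i : I) → S ⇒ V i
    u      : (i : I) → (V i × S) ⇒ S
    lu-eq  : (i : I) → l i ∘ u i ≈ π₁
    lu-neq : (i j : I) → ¬ (j ≡ i) → l j ∘ u i ≈ l j ∘ π₂

record ExceptionSemantics {o ℓ e ι} (D : Category o ℓ e) (Q : BinaryCoproducts D)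
       (I : Set ι) (S : Category.Obj D) (V : I → Category.Obj D)
       : Set (o ⊔ ℓ ⊔ e ⊔ ι) where
  open Category D
  open BinaryCoproducts Q
  field
    t      : (i : I) → V i ⇒ S
    c      : (i : I) → S ⇒ (V i + S)
    ct-eq  : (i : I) → c i ∘ t i ≈ inl
    ct-neq : (i j : I) → ¬ (j ≡ i) → c i ∘ t j ≈ inr ∘ t j

module Submission where

open import Defs
open import Data.Product using (Σ; _×_; _,_)
open import Function.Bundles using (_↔_; Inverse; mk↔ₛ′)
open import Relation.Binary.PropositionalEquality using (_≡_; refl)

-- In op C composition is reversed and π₁, π₂ serve as inl, inr, so the state
-- equations l ∘ u ≈ π₁ and l j ∘ u ≈ l j ∘ π₂ are literally the exception
-- equations c ∘ t ≈ inl and c ∘ t j ≈ inr ∘ t j; each field is carried over unchanged.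

module _ {o ℓ e ι} (C : Category o ℓ e) (P : BinaryProducts C)
         (I : Set ι) (S : Category.Obj C) (V : I → Category.Obj C) where

  state⇒exception : StateSemantics C P I S V →
                    ExceptionSemantics (op C) (op-coproducts P) I S V
  state⇒exception σ = record { t = l ; c = u ; ct-eq = lu-eq ; ct-neq = lu-neq }
    where open StateSemantics σ

  exception⇒state : ExceptionSemantics (op C) (op-coproducts P) I S V →
                    StateSemantics C P I S V
  exception⇒state ε = record { l = t ; u = c ; lu-eq = ct-eq ; lu-neq = ct-neq }
    where open ExceptionSemantics ε

  state↔exception : StateSemantics C P I S V ↔
                    ExceptionSemantics (op C) (op-coproducts P) I S V
  state↔exception =
    mk↔ₛ′ state⇒exception exception⇒state (λ _ → refl) (λ _ → refl)

theorem1 : ∀ {o ℓ e ι} (C : Category o ℓ e) (P : BinaryProducts C)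
    (I : Set ι) (S : Category.Obj C) (V : I → Category.Obj C) →
    Σ (StateSemantics C P I S V ↔ ExceptionSemantics (op C) (op-coproducts P) I S V)
    (λ bij → (σ : StateSemantics C P I S V) → (i : I) →
    (ExceptionSemantics.t (Inverse.to bij σ) i ≡ StateSemantics.l σ i)
    × (ExceptionSemantics.c (Inverse.to bij σ) i ≡ StateSemantics.u σ i))
theorem1 C P I S V = state↔exception C P I S V , λ σ i → refl , refl
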